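{- In a category $\mathcal{C}$ with cofibrations and an interval satisfying the general conditions (G1)–(G7) below, every object is a subobject of a fibrant object.
   Context: $\mathcal{C}$ is locally cartesian closed with finite colimits, with a class of maps called cofibrations (which are monomorphisms) and an interval $\delta_0,\delta_1\colon1\to\mathbb{I}$. Trivial fibrations: maps with the right lifting property (RLP) against all cofibrations. Fibrations: maps with the RLP against $\delta_0\hat\times m$ and $\delta_1\hat\times m$ for all cofibrations $m$ ($\hat\times$ the pushout product). $X$ is fibrant if $X\to1$ is a fibration. (G1) cofibrations are closed under pullback; (G2) cofibrations are closed under binary unions; (G3) $\mathbb{I}$ has connections $\wedge,\vee$ with $0\wedge i=i\wedge0=0$, $1\wedge i=i\wedge1=i$, $0\vee i=i\vee0=i$, $1\vee i=i\vee1=1$; (G4) $\delta_0,\delta_1$ are disjoint subobjects; (G5) $\delta_0,\delta_1$ are cofibrations; (G6) every map factors as a cofibration followed by a trivial fibration; (G7) every map $0\to X$ is a cofibration. -}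

module Defs where

open import Level using (Level; _⊔_) renaming (suc to lsuc)
open import Data.Product using (Σ; _×_; _,_; proj₁; proj₂)
open import Relation.Binary.PropositionalEquality
  using (_≡_; refl; sym; trans; cong; cong₂; module ≡-Reasoning)

record Category (o ℓ : Level) : Set (lsuc (o ⊔ ℓ)) where
  infixr 9 _∘_
  field
    Obj   : Set o
    Hom   : Obj → Obj → Set ℓ
    id    : ∀ {A} → Hom A A
    _∘_   : ∀ {A B C} → Hom B C → Hom A B → Hom A C
    idˡ   : ∀ {A B} {f : Hom A B} → id ∘ f ≡ f
    idʳ   : ∀ {A B} {f : Hom A B} → f ∘ id ≡ f
    assoc : ∀ {A B C D} {f : Hom A B} {g : Hom B C} {h : Hom C D} →
            (h ∘ g) ∘ f ≡ h ∘ (g ∘ f)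

module _ {o ℓ : Level} (𝒞 : Category o ℓ) where
  open Category 𝒞

  Mono : ∀ {A B} → Hom A B → Set (o ⊔ ℓ)
  Mono {A} m = ∀ {W} (g h : Hom W A) → m ∘ g ≡ m ∘ h → g ≡ h

  record IsTerminal (T : Obj) : Set (o ⊔ ℓ) where
    field
      !        : ∀ {X} → Hom X T
      !-unique : ∀ {X} (f : Hom X T) → f ≡ !

  record IsInitial (Z : Obj) : Set (o ⊔ ℓ) where
    field
      ¡        : ∀ {X} → Hom Z X
      ¡-unique : ∀ {X} (f : Hom Z X) → f ≡ ¡

  record IsPullback {A B C P : Obj} (f : Hom A C) (g : Hom B C)
                    (p₁ : Hom P A) (p₂ : Hom P B) : Set (o ⊔ ℓ) where
    field
      commute   : f ∘ p₁ ≡ g ∘ p₂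
      universal : ∀ {W} (h₁ : Hom W A) (h₂ : Hom W B) → f ∘ h₁ ≡ g ∘ h₂ → Hom W P
      univ-p₁   : ∀ {W} {h₁ : Hom W A} {h₂ : Hom W B} (e : f ∘ h₁ ≡ g ∘ h₂) →
                  p₁ ∘ universal h₁ h₂ e ≡ h₁
      univ-p₂   : ∀ {W} {h₁ : Hom W A} {h₂ : Hom W B} (e : f ∘ h₁ ≡ g ∘ h₂) →
                  p₂ ∘ universal h₁ h₂ e ≡ h₂
      unique    : ∀ {W} (u v : Hom W P) → p₁ ∘ u ≡ p₁ ∘ v → p₂ ∘ u ≡ p₂ ∘ v → u ≡ v

  record Pullback {A B C : Obj} (f : Hom A C) (g : Hom B C) : Set (o ⊔ ℓ) where
    field
      P          : Obj
      p₁         : Hom P A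
      p₂         : Hom P B
      isPullback : IsPullback f g p₁ p₂
    open IsPullback isPullback public

  record IsPushout {A B C Q : Obj} (f : Hom C A) (g : Hom C B)
                   (i₁ : Hom A Q) (i₂ : Hom B Q) : Set (o ⊔ ℓ) where
    field
      commute   : i₁ ∘ f ≡ i₂ ∘ g
      universal : ∀ {W} (h₁ : Hom A W) (h₂ : Hom B W) → h₁ ∘ f ≡ h₂ ∘ g → Hom Q W
      univ-i₁   : ∀ {W} {h₁ : Hom A W} {h₂ : Hom B W} (e : h₁ ∘ f ≡ h₂ ∘ g) →
                  universal h₁ h₂ e ∘ i₁ ≡ h₁
      univ-i₂   : ∀ {W} {h₁ : Hom A W} {h₂ : Hom B W} (e : h₁ ∘ f ≡ h₂ ∘ g) →
                  universal h₁ h₂ e ∘ i₂ ≡ h₂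
      unique    : ∀ {W} (u v : Hom Q W) → u ∘ i₁ ≡ v ∘ i₁ → u ∘ i₂ ≡ v ∘ i₂ → u ≡ v

  record Pushout {A B C : Obj} (f : Hom C A) (g : Hom C B) : Set (o ⊔ ℓ) where
    field
      Q         : Obj
      i₁        : Hom A Q
      i₂        : Hom B Q
      isPushout : IsPushout f g i₁ i₂
    open IsPushout isPushout public

  -- Dependent product Π_f (Z , g) along f : Y → X of an object g : Z → Y
  -- of the slice over Y, i.e. the value of a right adjoint to pullback
  -- f* : 𝒞/X → 𝒞/Y (with respect to the given choice of pullbacks).
  record DepProd (pb : ∀ {A B C} (f : Hom A C) (g : Hom B C) → Pullback f g)
                 {X Y Z : Obj} (f : Hom Y X) (g : Hom Z Y) : Set (o ⊔ ℓ) where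
    open Pullback
    field
      ΠObj    : Obj
      p       : Hom ΠObj X
      ev      : Hom (P (pb p f)) Z
      ev-over : g ∘ ev ≡ p₂ (pb p f)
      lam     : ∀ {W} (h : Hom W X) (k : Hom (P (pb h f)) Z) →
                g ∘ k ≡ p₂ (pb h f) → Hom W ΠObj
      lam-over : ∀ {W} {h : Hom W X} {k : Hom (P (pb h f)) Z} (e : g ∘ k ≡ p₂ (pb h f)) →
                 p ∘ lam h k e ≡ h
      -- ev ∘ f*(lam h k e) ≡ k, where f*(u) is the (unique) map m below
      lam-β   : ∀ {W} {h : Hom W X} {k : Hom (P (pb h f)) Z} (e : g ∘ k ≡ p₂ (pb h f))
                (m : Hom (P (pb h f)) (P (pb p f))) →
                p₁ (pb p f) ∘ m ≡ lam h k e ∘ p₁ (pb h f) →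
                p₂ (pb p f) ∘ m ≡ p₂ (pb h f) →
                ev ∘ m ≡ k
      lam-unique : ∀ {W} {h : Hom W X} {k : Hom (P (pb h f)) Z} (e : g ∘ k ≡ p₂ (pb h f))
                   (u : Hom W ΠObj) → p ∘ u ≡ h →
                   ((m : Hom (P (pb h f)) (P (pb p f))) →
                      p₁ (pb p f) ∘ m ≡ u ∘ p₁ (pb h f) →
                      p₂ (pb p f) ∘ m ≡ p₂ (pb h f) →
                      ev ∘ m ≡ k) →
                   u ≡ lam h k e

  _⋔_ : ∀ {A B X Y} → Hom A B → Hom X Y → Set ℓ
  _⋔_ {A} {B} {X} {Y} m p =
    (u : Hom A X) (v : Hom B Y) → p ∘ u ≡ v ∘ m →
    Σ (Hom B X) λ d → (d ∘ m ≡ u) × (p ∘ d ≡ v)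

record LCCCWithFiniteColimits {o ℓ : Level} (𝒞 : Category o ℓ) : Set (o ⊔ ℓ) where
  open Category 𝒞
  field
    ⊤          : Obj
    ⊤-terminal : IsTerminal 𝒞 ⊤
    pullback   : ∀ {A B C} (f : Hom A C) (g : Hom B C) → Pullback 𝒞 f g
    Π          : ∀ {X Y Z} (f : Hom Y X) (g : Hom Z Y) → DepProd 𝒞 pullback f g
    ⊥          : Obj
    ⊥-initial  : IsInitial 𝒞 ⊥
    pushout    : ∀ {A B C} (f : Hom C A) (g : Hom C B) → Pushout 𝒞 f g

  open IsTerminal ⊤-terminal public
  open IsInitial ⊥-initial public

  !-uniq₂ : ∀ {X} (f g : Hom X ⊤) → f ≡ g
  !-uniq₂ f g = trans (!-unique f) (sym (!-unique g))

  infixr 7 _×₀_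
  _×₀_ : Obj → Obj → Obj
  A ×₀ B = Pullback.P (pullback (! {A}) (! {B}))

  π₁ : ∀ {A B} → Hom (A ×₀ B) A
  π₁ {A} {B} = Pullback.p₁ (pullback (! {A}) (! {B}))

  π₂ : ∀ {A B} → Hom (A ×₀ B) B
  π₂ {A} {B} = Pullback.p₂ (pullback (! {A}) (! {B}))

  ⟨_,_⟩ : ∀ {W A B} → Hom W A → Hom W B → Hom W (A ×₀ B)
  ⟨_,_⟩ {W} {A} {B} a b =
    Pullback.universal (pullback (! {A}) (! {B})) a b (!-uniq₂ _ _)

  π₁-⟨⟩ : ∀ {W A B} (a : Hom W A) (b : Hom W B) → π₁ ∘ ⟨ a , b ⟩ ≡ a
  π₁-⟨⟩ {W} {A} {B} a b = Pullback.univ-p₁ (pullback (! {A}) (! {B})) (!-uniq₂ _ _)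

  π₂-⟨⟩ : ∀ {W A B} (a : Hom W A) (b : Hom W B) → π₂ ∘ ⟨ a , b ⟩ ≡ b
  π₂-⟨⟩ {W} {A} {B} a b = Pullback.univ-p₂ (pullback (! {A}) (! {B})) (!-uniq₂ _ _)

  ×-unique : ∀ {W A B} (u v : Hom W (A ×₀ B)) → π₁ ∘ u ≡ π₁ ∘ v → π₂ ∘ u ≡ π₂ ∘ v → u ≡ v
  ×-unique {W} {A} {B} = Pullback.unique (pullback (! {A}) (! {B}))

  infixr 8 _⊗_
  _⊗_ : ∀ {A B C D} → Hom A C → Hom B D → Hom (A ×₀ B) (C ×₀ D)
  f ⊗ g = ⟨ f ∘ π₁ , g ∘ π₂ ⟩

  private
    comp-lemma : ∀ {A B C D E} {π : Hom E A} {f : Hom A B} {g : Hom C A} {h : Hom D C}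
                 {k : Hom D E} → π ∘ k ≡ g ∘ h →
                 (f ∘ π) ∘ k ≡ (f ∘ g) ∘ h
    comp-lemma {π = π} {f} {g} {h} {k} e =
      trans assoc (trans (cong (f ∘_) e) (sym assoc))

  ⊗-∘ : ∀ {A B C D E F} (f : Hom C E) (g : Hom D F) (f' : Hom A C) (g' : Hom B D) →
        (f ⊗ g) ∘ (f' ⊗ g') ≡ (f ∘ f') ⊗ (g ∘ g')
  ⊗-∘ f g f' g' = ×-unique _ _
    (trans (sym assoc) (trans (cong (_∘ (f' ⊗ g')) (π₁-⟨⟩ _ _))
      (trans (comp-lemma (π₁-⟨⟩ _ _)) (sym (π₁-⟨⟩ _ _)))))
    (trans (sym assoc) (trans (cong (_∘ (f' ⊗ g')) (π₂-⟨⟩ _ _))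
      (trans (comp-lemma (π₂-⟨⟩ _ _)) (sym (π₂-⟨⟩ _ _)))))

  ⊗-interchange : ∀ {A B I} (δ : Hom ⊤ I) (m : Hom A B) →
                  (id ⊗ m) ∘ (δ ⊗ id) ≡ (δ ⊗ id) ∘ (id {⊤} ⊗ m)
  ⊗-interchange δ m =
    trans (⊗-∘ id m δ id)
      (trans (cong₂ _⊗_ (trans idˡ (sym idʳ)) (trans idʳ (sym idˡ)))
        (sym (⊗-∘ δ id id m)))

  PPdom : ∀ {A B I} → Hom ⊤ I → Hom A B → Obj
  PPdom δ m = Pushout.Q (pushout (δ ⊗ id) (id {⊤} ⊗ m))

  _×̂_ : ∀ {A B I} (δ : Hom ⊤ I) (m : Hom A B) → Hom (PPdom δ m) (I ×₀ B)
  δ ×̂ m = Pushout.universal (pushout (δ ⊗ id) (id {⊤} ⊗ m))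
            (id ⊗ m) (δ ⊗ id) (⊗-interchange δ m)

record CofibrationsAndInterval {o ℓ : Level} {𝒞 : Category o ℓ}
       (L : LCCCWithFiniteColimits 𝒞) (c : Level) : Set (o ⊔ ℓ ⊔ lsuc c) where
  open Category 𝒞
  open LCCCWithFiniteColimits L
  field
    Cof      : ∀ {A B} → Hom A B → Set c
    cof-mono : ∀ {A B} {m : Hom A B} → Cof m → Mono 𝒞 m
    𝕀        : Obj
    δ₀ δ₁    : Hom ⊤ 𝕀
    _∧_ _∨_  : Hom (𝕀 ×₀ 𝕀) 𝕀

  TrivFib : ∀ {X Y} → Hom X Y → Set (o ⊔ ℓ ⊔ c)
  TrivFib p = ∀ {A B} (m : Hom A B) → Cof m → _⋔_ 𝒞 m p

  Fib : ∀ {X Y} → Hom X Y → Set (o ⊔ ℓ ⊔ c)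
  Fib p = ∀ {A B} (m : Hom A B) → Cof m →
          _⋔_ 𝒞 (δ₀ ×̂ m) p × _⋔_ 𝒞 (δ₁ ×̂ m) p

  Fibrant : Obj → Set (o ⊔ ℓ ⊔ c)
  Fibrant X = Fib (! {X})

  c₀ c₁ : Hom 𝕀 𝕀
  c₀ = δ₀ ∘ !
  c₁ = δ₁ ∘ !

record GeneralConditions {o ℓ c : Level} {𝒞 : Category o ℓ}
       {L : LCCCWithFiniteColimits 𝒞} (S : CofibrationsAndInterval L c)
       : Set (o ⊔ ℓ ⊔ c) where
  open Category 𝒞
  open LCCCWithFiniteColimits L
  open CofibrationsAndInterval S
  field
    G1 : ∀ {A B C P} {m : Hom A C} {f : Hom B C} {p₁ : Hom P A} {p₂ : Hom P B} →
         IsPullback 𝒞 m f p₁ p₂ → Cof m → Cof p₂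
    -- (G2) cofibrations are closed under binary unions: for cofibrations
    -- m : A → X, n : B → X, the union A ∪ B = A +_{A ∩ B} B → X is a cofibration
    G2 : ∀ {A B X P Q} {m : Hom A X} {n : Hom B X} → Cof m → Cof n →
         {p₁ : Hom P A} {p₂ : Hom P B} → IsPullback 𝒞 m n p₁ p₂ →
         {i₁ : Hom A Q} {i₂ : Hom B Q} → IsPushout 𝒞 p₁ p₂ i₁ i₂ →
         (u : Hom Q X) → u ∘ i₁ ≡ m → u ∘ i₂ ≡ n → Cof u
    G3-∧-0l : _∧_ ∘ ⟨ c₀ , id ⟩ ≡ c₀
    G3-∧-0r : _∧_ ∘ ⟨ id , c₀ ⟩ ≡ c₀
    G3-∧-1l : _∧_ ∘ ⟨ c₁ , id ⟩ ≡ id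
    G3-∧-1r : _∧_ ∘ ⟨ id , c₁ ⟩ ≡ id
    G3-∨-0l : _∨_ ∘ ⟨ c₀ , id ⟩ ≡ id
    G3-∨-0r : _∨_ ∘ ⟨ id , c₀ ⟩ ≡ id
    G3-∨-1l : _∨_ ∘ ⟨ c₁ , id ⟩ ≡ c₁
    G3-∨-1r : _∨_ ∘ ⟨ id , c₁ ⟩ ≡ c₁
    -- (G4) δ₀, δ₁ are disjoint subobjects (δ₀, δ₁ : ⊤ → 𝕀 are automatically
    -- monic; disjointness: their pullback is initial)
    G4 : ∀ {P} {p₁ p₂ : Hom P ⊤} → IsPullback 𝒞 δ₀ δ₁ p₁ p₂ → IsInitial 𝒞 P
    G5-0 : Cof δ₀
    G5-1 : Cof δ₁
    G6 : ∀ {A B} (f : Hom A B) →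
         Σ Obj λ C → Σ (Hom A C) λ m → Σ (Hom C B) λ p →
           Cof m × TrivFib p × (p ∘ m ≡ f)
    G7 : ∀ {X} → Cof (¡ {X})

-- The pushout product δ ×̂ m of an endpoint δ with a cofibration m : A → B is
-- the union in 𝕀 × B of the subobjects 𝕀 × A and ⊤ × B, which meet in ⊤ × A;
-- both are pullbacks of cofibrations, so δ ×̂ m is a cofibration by (G1) and (G2).
-- Hence every trivial fibration is a fibration, and factoring X → ⊤ by (G6) as
-- a cofibration (a mono) followed by a trivial fibration embeds X into a
-- fibrant object.
module Submission where

open import Defs
open import Level using (Level)
open import Data.Product using (Σ; _×_; _,_)
open import Relation.Binary.PropositionalEquality
  using (_≡_; sym; trans; cong; subst; module ≡-Reasoning)

module Products {o ℓ : Level} {𝒞 : Category o ℓ} (L : LCCCWithFiniteColimits 𝒞) where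
  open Category 𝒞
  open LCCCWithFiniteColimits L
  open ≡-Reasoning

  π₁∘⊗ : ∀ {A B C D W} {f : Hom A C} {g : Hom B D} (h : Hom W (A ×₀ B)) →
         π₁ ∘ ((f ⊗ g) ∘ h) ≡ f ∘ (π₁ ∘ h)
  π₁∘⊗ h = trans (sym assoc) (trans (cong (_∘ h) (π₁-⟨⟩ _ _)) assoc)

  π₂∘⊗ : ∀ {A B C D W} {f : Hom A C} {g : Hom B D} (h : Hom W (A ×₀ B)) →
         π₂ ∘ ((f ⊗ g) ∘ h) ≡ g ∘ (π₂ ∘ h)
  π₂∘⊗ h = trans (sym assoc) (trans (cong (_∘ h) (π₂-⟨⟩ _ _)) assoc)

  π₁∘id⊗ : ∀ {A B D W} {g : Hom B D} (h : Hom W (A ×₀ B)) →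
           π₁ ∘ ((id ⊗ g) ∘ h) ≡ π₁ ∘ h
  π₁∘id⊗ h = trans (π₁∘⊗ h) idˡ

  π₂∘⊗id : ∀ {A B C W} {f : Hom A C} (h : Hom W (A ×₀ B)) →
           π₂ ∘ ((f ⊗ id) ∘ h) ≡ π₂ ∘ h
  π₂∘⊗id h = trans (π₂∘⊗ h) idˡ

  ⊗-square-π₁ : ∀ {A B C D A' B' W} {f : Hom A C} {g : Hom B D}
                {f' : Hom A' C} {g' : Hom B' D} {h : Hom W (A ×₀ B)} {h' : Hom W (A' ×₀ B')} →
                (f ⊗ g) ∘ h ≡ (f' ⊗ g') ∘ h' → f ∘ (π₁ ∘ h) ≡ f' ∘ (π₁ ∘ h')
  ⊗-square-π₁ e = trans (sym (π₁∘⊗ _)) (trans (cong (π₁ ∘_) e) (π₁∘⊗ _))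

  ⊗-square-π₂ : ∀ {A B C D A' B' W} {f : Hom A C} {g : Hom B D}
                {f' : Hom A' C} {g' : Hom B' D} {h : Hom W (A ×₀ B)} {h' : Hom W (A' ×₀ B')} →
                (f ⊗ g) ∘ h ≡ (f' ⊗ g') ∘ h' → g ∘ (π₂ ∘ h) ≡ g' ∘ (π₂ ∘ h')
  ⊗-square-π₂ e = trans (sym (π₂∘⊗ _)) (trans (cong (π₂ ∘_) e) (π₂∘⊗ _))

  id⊗-cancel-π₁ : ∀ {A B D W} {g : Hom B D} {u v : Hom W (A ×₀ B)} →
                  (id ⊗ g) ∘ u ≡ (id ⊗ g) ∘ v → π₁ ∘ u ≡ π₁ ∘ v
  id⊗-cancel-π₁ {u = u} {v} e = trans (sym (π₁∘id⊗ u)) (trans (cong (π₁ ∘_) e) (π₁∘id⊗ v))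

  ⊗id-cancel-π₂ : ∀ {A B C W} {f : Hom A C} {u v : Hom W (A ×₀ B)} →
                  (f ⊗ id) ∘ u ≡ (f ⊗ id) ∘ v → π₂ ∘ u ≡ π₂ ∘ v
  ⊗id-cancel-π₂ {u = u} {v} e = trans (sym (π₂∘⊗id u)) (trans (cong (π₂ ∘_) e) (π₂∘⊗id v))

  id⊗-isPullback : ∀ {I A C} (f : Hom A C) → IsPullback 𝒞 f (π₂ {I} {C}) π₂ (id ⊗ f)
  id⊗-isPullback f = record
    { commute   = sym (π₂-⟨⟩ _ _)
    ; universal = λ h₁ h₂ _ → ⟨ π₁ ∘ h₂ , h₁ ⟩
    ; univ-p₁   = λ _ → π₂-⟨⟩ _ _
    ; univ-p₂   = λ e → ×-unique _ _
        (trans (π₁∘id⊗ _) (π₁-⟨⟩ _ _))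
        (trans (π₂∘⊗ _) (trans (cong (f ∘_) (π₂-⟨⟩ _ _)) e))
    ; unique    = λ u v e₁ e₂ → ×-unique u v (id⊗-cancel-π₁ e₂) e₁
    }

  ⊗id-isPullback : ∀ {A C B} (f : Hom A C) → IsPullback 𝒞 f (π₁ {C} {B}) π₁ (f ⊗ id)
  ⊗id-isPullback f = record
    { commute   = sym (π₁-⟨⟩ _ _)
    ; universal = λ h₁ h₂ _ → ⟨ h₁ , π₂ ∘ h₂ ⟩
    ; univ-p₁   = λ _ → π₁-⟨⟩ _ _
    ; univ-p₂   = λ e → ×-unique _ _
        (trans (π₁∘⊗ _) (trans (cong (f ∘_) (π₁-⟨⟩ _ _)) e))
        (trans (π₂∘⊗id _) (π₂-⟨⟩ _ _))
    ; unique    = λ u v e₁ e₂ → ×-unique u v e₁ (⊗id-cancel-π₂ e₂)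
    }

  ⊗-interchange-isPullback : ∀ {I A B} (δ : Hom ⊤ I) (m : Hom A B) →
    IsPullback 𝒞 (id ⊗ m) (δ ⊗ id) (δ ⊗ id) (id ⊗ m)
  ⊗-interchange-isPullback {A = A} {B} δ m = record
    { commute   = ⊗-interchange δ m
    ; universal = λ h₁ _ _ → ⟨ ! , π₂ ∘ h₁ ⟩
    ; univ-p₁   = univ-p₁
    ; univ-p₂   = univ-p₂
    ; unique    = λ u v e₁ _ → ×-unique u v (!-uniq₂ _ _) (⊗id-cancel-π₂ e₁)
    }
    where
    univ-p₁ : ∀ {W} {h₁ : Hom W (_ ×₀ A)} {h₂ : Hom W (⊤ ×₀ B)} →
              (id ⊗ m) ∘ h₁ ≡ (δ ⊗ id) ∘ h₂ → (δ ⊗ id) ∘ ⟨ ! , π₂ ∘ h₁ ⟩ ≡ h₁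
    univ-p₁ {h₁ = h₁} {h₂} e = ×-unique _ _
      (begin
        π₁ ∘ ((δ ⊗ id) ∘ ⟨ ! , π₂ ∘ h₁ ⟩) ≡⟨ π₁∘⊗ _ ⟩
        δ ∘ (π₁ ∘ ⟨ ! , π₂ ∘ h₁ ⟩)        ≡⟨ cong (δ ∘_) (!-uniq₂ _ _) ⟩
        δ ∘ (π₁ ∘ h₂)                     ≡⟨ sym (⊗-square-π₁ e) ⟩
        id ∘ (π₁ ∘ h₁)                    ≡⟨ idˡ ⟩
        π₁ ∘ h₁                           ∎)
      (trans (π₂∘⊗id _) (π₂-⟨⟩ _ _))

    univ-p₂ : ∀ {W} {h₁ : Hom W (_ ×₀ A)} {h₂ : Hom W (⊤ ×₀ B)} →
              (id ⊗ m) ∘ h₁ ≡ (δ ⊗ id) ∘ h₂ → (id ⊗ m) ∘ ⟨ ! , π₂ ∘ h₁ ⟩ ≡ h₂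
    univ-p₂ {h₁ = h₁} {h₂} e = ×-unique _ _
      (!-uniq₂ _ _)
      (begin
        π₂ ∘ ((id ⊗ m) ∘ ⟨ ! , π₂ ∘ h₁ ⟩) ≡⟨ π₂∘⊗ _ ⟩
        m ∘ (π₂ ∘ ⟨ ! , π₂ ∘ h₁ ⟩)        ≡⟨ cong (m ∘_) (π₂-⟨⟩ _ _) ⟩
        m ∘ (π₂ ∘ h₁)                     ≡⟨ ⊗-square-π₂ e ⟩
        id ∘ (π₂ ∘ h₂)                    ≡⟨ idˡ ⟩
        π₂ ∘ h₂                           ∎)

module Fibrancy {o ℓ c : Level} {𝒞 : Category o ℓ} {L : LCCCWithFiniteColimits 𝒞}
    {S : CofibrationsAndInterval L c} (G : GeneralConditions S) where
  open Category 𝒞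
  open LCCCWithFiniteColimits L
  open CofibrationsAndInterval S
  open GeneralConditions G
  open Products L

  ×̂-Cof : ∀ {I A B} {δ : Hom ⊤ I} {m : Hom A B} → Cof δ → Cof m → Cof (δ ×̂ m)
  ×̂-Cof {δ = δ} {m} cof-δ cof-m =
    G2 (G1 (id⊗-isPullback m) cof-m) (G1 (⊗id-isPullback δ) cof-δ)
       (⊗-interchange-isPullback δ m) isPushout (δ ×̂ m) (univ-i₁ _) (univ-i₂ _)
    where open Pushout (pushout (δ ⊗ id) (id {⊤} ⊗ m))

  TrivFib⇒Fib : ∀ {X Y} {p : Hom X Y} → TrivFib p → Fib p
  TrivFib⇒Fib triv m cof-m = triv _ (×̂-Cof G5-0 cof-m) , triv _ (×̂-Cof G5-1 cof-m)

  embedIntoFibrant : (X : Obj) → Σ Obj λ Y → Σ (Hom X Y) λ m → Mono 𝒞 m × Fibrant Y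
  embedIntoFibrant X with G6 (! {X})
  ... | Y , m , p , cof-m , triv-p , _ =
    Y , m , cof-mono cof-m , TrivFib⇒Fib (subst TrivFib (!-unique p) triv-p)

mainTheorem7 : ∀ {o ℓ c : Level} (𝒞 : Category o ℓ) (L : LCCCWithFiniteColimits 𝒞)
                 (S : CofibrationsAndInterval L c) → GeneralConditions S →
                 (X : Category.Obj 𝒞) →
                 Σ (Category.Obj 𝒞) λ Y → Σ (Category.Hom 𝒞 X Y) λ m →
                   Mono 𝒞 m × CofibrationsAndInterval.Fibrant S Y
mainTheorem7 𝒞 L S G = Fibrancy.embedIntoFibrant G
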